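{- If $D$ is a finite simple digraph of order $n$ with $\gamma_I(D)\geq 3$, then $r_I(D)\leq n-\Delta^+(D)-\gamma_I(D)+2$.
   Context: A finite simple digraph has no loops and no multiple arcs (oppositely oriented arcs allowed); $\Delta^+(D)$ is its maximum out-degree. An Italian dominating function (IDF) on $D$ is a function $f:V(D)\to\{0,1,2\}$ such that every vertex $v$ with $f(v)=0$ has at least two in-neighbors $w$ with $f(w)=1$ or at least one in-neighbor $w$ with $f(w)=2$; its weight is $\sum_u f(u)$ and $\gamma_I(D)$ is the minimum weight of an IDF. For a set $R$ of arcs not in $A(D)$ (between distinct vertices), $D+R$ is $D$ with these arcs added; $R$ is an Italian reinforcement set if $\gamma_I(D+R)<\gamma_I(D)$. The Italian reinforcement number $r_I(D)$ is the minimum size of such a set, defined to be $0$ if $\gamma_I(D)\leq 2$. -}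

module Defs where

open import Data.Nat using (ℕ; zero; suc; _+_; _≤_; _<_; _⊔_)
open import Data.Bool using (Bool; true; false; _∨_; _∧_)
open import Data.Fin using (Fin; zero; suc; toℕ)
open import Data.Product using (Σ; _×_; _,_; ∃)
open import Data.Sum using (_⊎_)
open import Relation.Binary.PropositionalEquality using (_≡_; _≢_)

b2n : Bool → ℕ
b2n true = 1
b2n false = 0

count : ∀ {n} → (Fin n → Bool) → ℕ
count {zero} p = 0
count {suc n} p = b2n (p zero) + count (λ i → p (suc i))

sumF : ∀ {n} → (Fin n → ℕ) → ℕ
sumF {zero} f = 0
sumF {suc n} f = f zero + sumF (λ i → f (suc i))

maxF : ∀ {n} → (Fin n → ℕ) → ℕ
maxF {zero} f = 0
maxF {suc n} f = f zero ⊔ maxF (λ i → f (suc i))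

-- A finite simple digraph on vertex set Fin n: arc u → v iff arc u v ≡ true.
-- A Boolean relation has no multiple arcs; loops are excluded explicitly.
record Digraph (n : ℕ) : Set where
  field
    arc      : Fin n → Fin n → Bool
    loopless : ∀ v → arc v v ≡ false
open Digraph public

outdeg : ∀ {n} → Digraph n → Fin n → ℕ
outdeg D v = count (λ w → arc D v w)

Δ⁺ : ∀ {n} → Digraph n → ℕ
Δ⁺ D = maxF (outdeg D)

𝟘 𝟙 𝟚 : Fin 3
𝟘 = zero
𝟙 = suc zero
𝟚 = suc (suc zero)

isOne : Fin 3 → Bool
isOne (suc zero) = true
isOne _ = false

weight : ∀ {n} → (Fin n → Fin 3) → ℕ
weight f = sumF (λ v → toℕ (f v))

IsIDF : ∀ {n} → Digraph n → (Fin n → Fin 3) → Set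
IsIDF D f = ∀ v → f v ≡ 𝟘 →
    (2 ≤ count (λ w → arc D w v ∧ isOne (f w)))
  ⊎ (∃ λ w → arc D w v ≡ true × f w ≡ 𝟚)

IsItalianDomNumber : ∀ {n} → Digraph n → ℕ → Set
IsItalianDomNumber D k =
  (∃ λ f → IsIDF D f × weight f ≡ k) × (∀ f → IsIDF D f → k ≤ weight f)

record ArcSet {n : ℕ} (D : Digraph n) : Set where
  field
    new     : Fin n → Fin n → Bool
    notLoop : ∀ u v → new u v ≡ true → u ≢ v
    notInD  : ∀ u v → new u v ≡ true → arc D u v ≡ false
open ArcSet public

size : ∀ {n} {D : Digraph n} → ArcSet D → ℕ
size R = sumF (λ u → count (λ v → new R u v))

_+ᴬ_ : ∀ {n} (D : Digraph n) → ArcSet D → Digraph n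
arc (D +ᴬ R) u v = arc D u v ∨ new R u v
loopless (D +ᴬ R) v = helper (arc D v v) (new R v v) (loopless D v) (λ e → notLoop R v v e _≡_.refl)
  where
  open import Data.Empty using (⊥-elim)
  helper : (a b : Bool) → a ≡ false → (b ≡ true → Data.Empty.⊥) → a ∨ b ≡ false
  helper false false _ _ = _≡_.refl
  helper false true _ h = ⊥-elim (h _≡_.refl)
  helper true _ () _

IsItalianReinforcementSet : ∀ {n} (D : Digraph n) → ArcSet D → Set
IsItalianReinforcementSet D R =
  ∀ g g′ → IsItalianDomNumber D g → IsItalianDomNumber (D +ᴬ R) g′ → g′ < g

IsItalianReinforcementNumber : ∀ {n} → Digraph n → ℕ → Set
IsItalianReinforcementNumber D r =
    (∃ λ g → IsItalianDomNumber D g × g ≤ 2 × r ≡ 0)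
  ⊎ ((∃ λ g → IsItalianDomNumber D g × 3 ≤ g)
     × (∃ λ R → IsItalianReinforcementSet D R × size R ≡ r)
     × (∀ R → IsItalianReinforcementSet D R → r ≤ size R))

-- Let v be a vertex of maximum out-degree Δ and let far be the set of the n - 1 - Δ vertices
-- that are neither v nor out-neighbours of v. Giving v the value 2 and every vertex of far the
-- value 1 is an IDF, so γ ≤ 2 + |far|. Adding arcs from v to k ≤ |far| vertices of far lets
-- them drop to 0, leaving an IDF of weight 2 + |far| - k; for k = |far| + 3 - γ this is γ - 1,
-- hence r ≤ |far| + 3 - γ = n + 2 - Δ - γ. That r exists at all is a finite search: whether some
-- arc set of a given size reinforces D is decidable, by exhausting all arc relations and all
-- functions into {0,1,2}.
module Submission where

open import Defs
open import Data.Nat using (ℕ; _+_; _≤_)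
open import Data.Product using (Σ; _×_; ∃)

open import Level using (0ℓ)
open import Function using (_∘_)
open import Data.Nat using (zero; suc; _<_; _≤?_; _<?_)
open import Data.Nat.Properties
open import Data.Nat.Induction using (<-wellFounded)
open import Induction.WellFounded using (Acc; acc)
open import Data.Bool using (Bool; true; false; _∨_; _∧_; not)
import Data.Bool.Properties as Boolₚ
open import Data.Fin using (Fin; zero; suc; toℕ)
import Data.Fin.Properties as Finₚ
open import Data.Vec.Functional using (_∷_; head; tail)
open import Data.Product using (_,_; proj₁; proj₂)
open import Data.Sum using (_⊎_; inj₁; inj₂)
open import Relation.Nullary using (Dec; yes; no; ¬?)
open import Relation.Nullary.Decidable using (does; dec-true; map′; _×-dec_; _⊎-dec_; _→-dec_)
open import Relation.Unary using (Pred; Decidable)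
open import Relation.Binary using (Setoid)
open import Relation.Binary.Definitions using (_Respects_)
import Relation.Binary.Indexed.Heterogeneous.Construct.Trivial as Trivial
open import Function.Indexed.Relation.Binary.Equality using (≡-setoid)
open import Relation.Binary.PropositionalEquality

infix 4 _⊆ᵇ_

_⊆ᵇ_ : ∀ {n} → (Fin n → Bool) → (Fin n → Bool) → Set
q ⊆ᵇ p = ∀ i → q i ≡ true → p i ≡ true

count-cong : ∀ {n} {p q : Fin n → Bool} → (∀ i → p i ≡ q i) → count p ≡ count q
count-cong {zero} _ = refl
count-cong {suc n} p≗q = cong₂ _+_ (cong b2n (p≗q zero)) (count-cong (p≗q ∘ suc))

sumF-cong : ∀ {n} {f g : Fin n → ℕ} → (∀ i → f i ≡ g i) → sumF f ≡ sumF g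
sumF-cong {zero} _ = refl
sumF-cong {suc n} f≗g = cong₂ _+_ (f≗g zero) (sumF-cong (f≗g ∘ suc))

count-false : ∀ n → count {n} (λ _ → false) ≡ 0
count-false zero = refl
count-false (suc n) = count-false n

sumF-zero : ∀ {n} {f : Fin n → ℕ} → (∀ i → f i ≡ 0) → sumF f ≡ 0
sumF-zero {zero} _ = refl
sumF-zero {suc n} f≗0 = cong₂ _+_ (f≗0 zero) (sumF-zero (f≗0 ∘ suc))

count-split : ∀ {n} (p b : Fin n → Bool) →
  count p ≡ count (λ i → p i ∧ b i) + count (λ i → p i ∧ not (b i))
count-split {zero} p b = refl
count-split {suc n} p b with p zero | b zero | count-split (tail p) (tail b)
... | true  | true  | ih = cong suc ih
... | true  | false | ih = trans (cong suc ih) (sym (+-suc _ _))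
... | false | _     | ih = ih

count-complement : ∀ {n} (b : Fin n → Bool) → count b + count (not ∘ b) ≡ n
count-complement {zero} b = refl
count-complement {suc n} b with b zero | count-complement (tail b)
... | true  | ih = cong suc ih
... | false | ih = trans (+-suc _ _) (cong suc ih)

count-∧-⊆ : ∀ {n} {p q : Fin n → Bool} → q ⊆ᵇ p → count (λ i → p i ∧ q i) ≡ count q
count-∧-⊆ {p = p} {q} q⊆p = count-cong p∧q≡q
  where
  p∧q≡q : ∀ i → p i ∧ q i ≡ q i
  p∧q≡q i with q i in qi
  ... | true  = trans (cong (_∧ true) (q⊆p i qi)) refl
  ... | false = Boolₚ.∧-zeroʳ (p i)

count-singleton : ∀ {n} (v : Fin n) → count (λ w → does (w Finₚ.≟ v)) ≡ 1
count-singleton {suc n} zero = cong suc (count-false n)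
count-singleton {suc n} (suc v) = count-singleton v

sumF-count-row : ∀ {n m} (v : Fin n) (q : Fin m → Bool) →
  sumF (λ u → count (λ w → does (u Finₚ.≟ v) ∧ q w)) ≡ count q
sumF-count-row {suc n} {m} zero q = begin
  count q + sumF {n} (λ _ → count {m} (λ _ → false))
    ≡⟨ cong (count q +_) (sumF-zero {n} (λ _ → count-false m)) ⟩
  count q + 0
    ≡⟨ +-identityʳ (count q) ⟩
  count q
    ∎
  where open ≡-Reasoning
sumF-count-row {m = m} (suc v) q = cong₂ _+_ (count-false m) (sumF-count-row v q)

count-select : ∀ {n} (p : Fin n → Bool) {k} → k ≤ count p →
  ∃ λ q → q ⊆ᵇ p × count q ≡ k
count-select {n} p {zero} _ = (λ _ → false) , (λ _ ()) , count-false n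
count-select {suc n} p {suc k} k<#p with p zero in p0
... | true  = let q , q⊆p , #q = count-select (tail p) (≤-pred k<#p)
              in (true ∷ q) , (λ { zero _ → p0 ; (suc i) → q⊆p i }) , cong suc #q
... | false = let q , q⊆p , #q = count-select (tail p) k<#p
              in (false ∷ q) , (λ { zero () ; (suc i) → q⊆p i }) , #q

maxF-attained : ∀ {n} (f : Fin (suc n) → ℕ) → ∃ λ v → f v ≡ maxF f
maxF-attained {zero} f = zero , sym (⊔-identityʳ (f zero))
maxF-attained {suc n} f with maxF-attained (tail f) | ≤-total (f zero) (maxF (tail f))
... | v , fv≡max | inj₁ f0≤max = suc v , trans fv≡max (sym (m≤n⇒m⊔n≡n f0≤max))
... | _ | inj₂ max≤f0 = zero , sym (m≥n⇒m⊔n≡m max≤f0)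

Fin→ₛ : ℕ → Setoid 0ℓ 0ℓ → Setoid 0ℓ 0ℓ
Fin→ₛ n S = ≡-setoid (Fin n) (Trivial.indexedSetoid S)

Exhaustible : Setoid 0ℓ 0ℓ → Set₁
Exhaustible S = ∀ {P : Pred Carrier 0ℓ} → P Respects _≈_ → Decidable P → Dec (∃ P)
  where open Setoid S

exhaustible-Fin : ∀ k → Exhaustible (setoid (Fin k))
exhaustible-Fin k _ P? = Finₚ.any? P?

exhaustible-Bool : Exhaustible (setoid Bool)
exhaustible-Bool {P} _ P? = map′ from-⊎ to-⊎ (P? true ⊎-dec P? false)
  where
  from-⊎ : P true ⊎ P false → ∃ P
  from-⊎ (inj₁ p) = true , p
  from-⊎ (inj₂ p) = false , p
  to-⊎ : ∃ P → P true ⊎ P false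
  to-⊎ (true , p) = inj₁ p
  to-⊎ (false , p) = inj₂ p

exhaustible-Fin→ : ∀ {S} → Exhaustible S → ∀ n → Exhaustible (Fin→ₛ n S)
exhaustible-Fin→ {S} _ zero {P} resp P? =
  map′ (λ p → empty , p) (λ (f , p) → resp {f} {empty} (λ ()) p) (P? empty)
  where
  empty : Fin 0 → Setoid.Carrier S
  empty ()
exhaustible-Fin→ {S} exhaust (suc n) {P} resp P? =
  map′ (λ (a , f , p) → a ∷ f , p)
       (λ (f , p) → head f , tail f , resp (λ { zero → S.refl ; (suc _) → S.refl }) p)
       (exhaust respHead (λ a → exhaustible-Fin→ {S} exhaust n (respTail a) (P? ∘ (a ∷_))))
  where
  module S = Setoid S
  respHead : (λ a → ∃ λ f → P (a ∷ f)) Respects S._≈_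
  respHead a≈b (f , p) = f , resp (λ { zero → a≈b ; (suc _) → S.refl }) p
  respTail : ∀ a → (λ f → P (a ∷ f)) Respects Setoid._≈_ (Fin→ₛ n S)
  respTail a f≈g = resp (λ { zero → S.refl ; (suc i) → f≈g i })

module _ {P : Pred ℕ 0ℓ} (P? : Decidable P) where

  minimal : ∀ k → P k → ∃ λ m → P m × (∀ j → P j → m ≤ j)
  minimal k = below k (<-wellFounded k)
    where
    below : ∀ k → Acc _<_ k → P k → ∃ λ m → P m × (∀ j → P j → m ≤ j)
    below k (acc smaller) pk with anyUpTo? P? k
    ... | yes (j , j<k , pj) = below j (smaller j<k) pj
    ... | no none = k , pk , λ j pj → ≮⇒≥ (λ j<k → none (j , j<k , pj))

Arcs : ℕ → Set
Arcs n = Fin n → Fin n → Bool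

-- Italian domination for a raw arc relation, so that candidate arc sets can be searched;
-- IsIDF D f is definitionally IsIDFᵃ (arc D) f.
IsIDFᵃ : ∀ {n} → Arcs n → (Fin n → Fin 3) → Set
IsIDFᵃ a f = ∀ v → f v ≡ 𝟘 →
    (2 ≤ count (λ w → a w v ∧ isOne (f w)))
  ⊎ (∃ λ w → a w v ≡ true × f w ≡ 𝟚)

isIDF? : ∀ {n} (a : Arcs n) f → Dec (IsIDFᵃ a f)
isIDF? a f = Finₚ.all? λ v → (f v Finₚ.≟ 𝟘) →-dec
  ((2 ≤? count (λ w → a w v ∧ isOne (f w))) ⊎-dec
   Finₚ.any? (λ w → (a w v Boolₚ.≟ true) ×-dec (f w Finₚ.≟ 𝟚)))

isIDF-cong : ∀ {n} {a b : Arcs n} {f g : Fin n → Fin 3} →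
  (∀ u v → a u v ≡ b u v) → (∀ i → f i ≡ g i) → IsIDFᵃ a f → IsIDFᵃ b g
isIDF-cong a≗b f≗g idf v gv≡0 with idf v (trans (f≗g v) gv≡0)
... | inj₁ two-ones =
  inj₁ (subst (2 ≤_) (count-cong (λ w → cong₂ _∧_ (a≗b w v) (cong isOne (f≗g w)))) two-ones)
... | inj₂ (w , wv , fw≡2) = inj₂ (w , trans (sym (a≗b w v)) wv , trans (sym (f≗g w)) fw≡2)

weight-cong : ∀ {n} {f g : Fin n → Fin 3} → (∀ i → f i ≡ g i) → weight f ≡ weight g
weight-cong f≗g = sumF-cong (cong toℕ ∘ f≗g)

exhaustible-IDF : ∀ n → Exhaustible (Fin→ₛ n (setoid (Fin 3)))
exhaustible-IDF n = exhaustible-Fin→ {setoid (Fin 3)} (exhaustible-Fin 3) n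

lighterIDF? : ∀ {n} (a : Arcs n) γ → Dec (∃ λ f → IsIDFᵃ a f × weight f < γ)
lighterIDF? {n} a γ = exhaustible-IDF n
  (λ f≗g (idf , f<γ) → isIDF-cong (λ _ _ → refl) f≗g idf , subst (_< γ) (weight-cong f≗g) f<γ)
  (λ f → isIDF? a f ×-dec (weight f <? γ))

italianDomNumber-exists : ∀ {n} (D : Digraph n) → ∃ (IsItalianDomNumber D)
italianDomNumber-exists {n} D with minimal hasIDF? (weight ones) (ones , (λ _ ()) , refl)
  where
  ones : Fin n → Fin 3
  ones _ = 𝟙
  HasIDF : ℕ → Set
  HasIDF m = ∃ λ f → IsIDF D f × weight f ≡ m
  hasIDF? : Decidable HasIDF
  hasIDF? m = exhaustible-IDF n
    (λ f≗g (idf , w) → isIDF-cong (λ _ _ → refl) f≗g idf , trans (sym (weight-cong f≗g)) w)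
    (λ f → isIDF? (arc D) f ×-dec (weight f ≟ m))
... | γ , γ-attained , γ-least = γ , γ-attained , λ f idf → γ-least (weight f) (f , idf , refl)

italianDomNumber-unique : ∀ {n} {D : Digraph n} {g h} →
  IsItalianDomNumber D g → IsItalianDomNumber D h → g ≡ h
italianDomNumber-unique ((f , idf , wf) , g-least) ((f′ , idf′ , wf′) , h-least) =
  ≤-antisym (subst (_ ≤_) wf′ (g-least f′ idf′)) (subst (_ ≤_) wf (h-least f idf))

module Reinforcement {n} (D : Digraph n) {γ} (γ-dom : IsItalianDomNumber D γ) where

  lighterIDF⇒reinforcing : ∀ R → (∃ λ f → IsIDF (D +ᴬ R) f × weight f < γ) →
    IsItalianReinforcementSet D R
  lighterIDF⇒reinforcing R (f , idf , f<γ) g g′ g-dom g′-dom =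
    subst (g′ <_) (italianDomNumber-unique {D = D} γ-dom g-dom) (≤-<-trans (proj₂ g′-dom f idf) f<γ)

  reinforcing⇒lighterIDF : ∀ R → IsItalianReinforcementSet D R →
    ∃ λ f → IsIDF (D +ᴬ R) f × weight f < γ
  reinforcing⇒lighterIDF R reinforcing with italianDomNumber-exists (D +ᴬ R)
  ... | g′ , g′-dom@((f , idf , wf) , _) =
    f , idf , subst (_< γ) (sym wf) (reinforcing γ g′ γ-dom g′-dom)

  -- An Italian reinforcement set of size m, unbundled into a decidable predicate on raw
  -- relations; by the two lemmas above, weight f < γ stands for γ_I(D + R) < γ.
  ReinforcingArcs : Arcs n → ℕ → Set
  ReinforcingArcs new m =
      (∀ u v → new u v ≡ true → u ≢ v)
    × (∀ u v → new u v ≡ true → arc D u v ≡ false)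
    × sumF (λ u → count (new u)) ≡ m
    × ∃ λ f → IsIDFᵃ (λ u v → arc D u v ∨ new u v) f × weight f < γ

  reinforcingArcs-cong : ∀ {m} → (λ new → ReinforcingArcs new m) Respects
    Setoid._≈_ (Fin→ₛ n (Fin→ₛ n (setoid Bool)))
  reinforcingArcs-cong new≗new′ (loopless , fresh , size≡m , f , idf , f<γ) =
      (λ u v e → loopless u v (trans (new≗new′ u v) e))
    , (λ u v e → fresh u v (trans (new≗new′ u v) e))
    , trans (sym (sumF-cong (λ u → count-cong (new≗new′ u)))) size≡m
    , f , isIDF-cong (λ u v → cong (arc D u v ∨_) (new≗new′ u v)) (λ _ → refl) idf , f<γ

  reinforcingArcs? : ∀ m → Dec (∃ λ new → ReinforcingArcs new m)
  reinforcingArcs? m =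
    exhaustible-Fin→ {Fin→ₛ n (setoid Bool)} (exhaustible-Fin→ {setoid Bool} exhaustible-Bool n) n
    reinforcingArcs-cong
    (λ new → Finₚ.all? (λ u → Finₚ.all? λ v → (new u v Boolₚ.≟ true) →-dec ¬? (u Finₚ.≟ v))
      ×-dec Finₚ.all? (λ u → Finₚ.all? λ v → (new u v Boolₚ.≟ true) →-dec (arc D u v Boolₚ.≟ false))
      ×-dec (sumF (λ u → count (new u)) ≟ m)
      ×-dec lighterIDF? _ γ)

  toArcSet : ∀ {new m} → ReinforcingArcs new m → ArcSet D
  toArcSet {new} (loopless , fresh , _) = record { new = new ; notLoop = loopless ; notInD = fresh }

  reinforcing⇒reinforcingArcs : ∀ R → IsItalianReinforcementSet D R → ReinforcingArcs (new R) (size R)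
  reinforcing⇒reinforcingArcs R reinforcing =
    notLoop R , notInD R , refl , reinforcing⇒lighterIDF R reinforcing

  reinforcementNumber-exists : 3 ≤ γ → ∀ R → IsItalianReinforcementSet D R →
    ∃ λ r → IsItalianReinforcementNumber D r × r ≤ size R
  reinforcementNumber-exists 3≤γ R reinforcing
    with minimal reinforcingArcs? (size R) (new R , reinforcing⇒reinforcingArcs R reinforcing)
  ... | r , (_ , arcs@(_ , _ , size≡r , lighter)) , r-least =
    r , inj₂ ( (γ , γ-dom , 3≤γ)
             , (toArcSet arcs , lighterIDF⇒reinforcing (toArcSet arcs) lighter , size≡r)
             , λ R′ reinforcing′ →
                 r-least (size R′) (new R′ , reinforcing⇒reinforcingArcs R′ reinforcing′))
      , r-least (size R) (new R , reinforcing⇒reinforcingArcs R reinforcing)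

∧-true : ∀ x {y} → x ∧ y ≡ true → x ≡ true × y ≡ true
∧-true true y≡true = refl , y≡true

not-true : ∀ {x} → not x ≡ true → x ≡ false
not-true {false} _ = refl

not-∧-not-∨ : ∀ x y z → not x ∧ not (y ∨ z) ≡ (not x ∧ not y) ∧ not z
not-∧-not-∨ true  _     _ = refl
not-∧-not-∨ false true  _ = refl
not-∧-not-∨ false false _ = refl

twoOrOne : Bool → Bool → Fin 3
twoOrOne true  _     = 𝟚
twoOrOne false true  = 𝟙
twoOrOne false false = 𝟘

twoOrOne≡𝟘 : ∀ x y → twoOrOne x y ≡ 𝟘 → y ≡ false
twoOrOne≡𝟘 false false _ = refl

weight-twoOrOne : ∀ {n} (t o : Fin n → Bool) →
  weight (λ w → twoOrOne (t w) (o w)) ≡ count t + count t + count (λ w → not (t w) ∧ o w)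
weight-twoOrOne {zero} t o = refl
weight-twoOrOne {suc n} t o
  with t zero | o zero | weight-twoOrOne (tail t) (tail o)
... | true  | _     | ih = trans (cong (2 +_) ih) (cong suc (sym (cong (_+ ∣o∣) (+-suc ∣t∣ ∣t∣))))
  where
  ∣t∣ ∣o∣ : ℕ
  ∣t∣ = count (tail t)
  ∣o∣ = count (λ w → not (tail t w) ∧ tail o w)
... | false | true  | ih = trans (cong suc ih) (sym (+-suc _ _))
... | false | false | ih = ih

k+Δ+γ≡n+2 : ∀ {n Δ γ f k} → n ≡ suc (Δ + f) → γ + k ≡ 3 + f → k + Δ + γ ≡ n + 2
k+Δ+γ≡n+2 {n} {Δ} {γ} {f} {k} n≡ γ+k≡ = begin
  k + Δ + γ       ≡⟨ +-comm (k + Δ) γ ⟩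
  γ + (k + Δ)     ≡⟨ sym (+-assoc γ k Δ) ⟩
  γ + k + Δ       ≡⟨ cong (_+ Δ) γ+k≡ ⟩
  3 + (f + Δ)     ≡⟨ cong (3 +_) (+-comm f Δ) ⟩
  3 + (Δ + f)     ≡⟨ cong suc (+-comm 2 (Δ + f)) ⟩
  suc (Δ + f) + 2 ≡⟨ cong (_+ 2) (sym n≡) ⟩
  n + 2           ∎
  where open ≡-Reasoning

module Construction {n} (D : Digraph n) (v : Fin n) where

  isV out far : Fin n → Bool
  isV w = does (w Finₚ.≟ v)
  out = arc D v
  far w = not (isV w) ∧ not (out w)

  far⇒≢v : ∀ w → far w ≡ true → w ≢ v
  far⇒≢v w fw w≡v
    with () ← trans (sym (dec-true (w Finₚ.≟ v) w≡v)) (not-true (proj₁ (∧-true (not (isV w)) fw)))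

  far⇒¬out : ∀ w → far w ≡ true → out w ≡ false
  far⇒¬out w fw = not-true (proj₂ (∧-true (not (isV w)) fw))

  n≡1+outdeg+far : n ≡ suc (outdeg D v + count far)
  n≡1+outdeg+far = begin
    n
      ≡⟨ sym (count-complement isV) ⟩
    count isV + count (not ∘ isV)
      ≡⟨ cong₂ _+_ (count-singleton v) (count-split (not ∘ isV) out) ⟩
    suc (count (λ w → not (isV w) ∧ out w) + count far)
      ≡⟨ cong (λ c → suc (c + count far)) (count-cong ¬v∧out≡out) ⟩
    suc (outdeg D v + count far)
      ∎
    where
    open ≡-Reasoning
    ¬v∧out≡out : ∀ w → not (isV w) ∧ out w ≡ out w
    ¬v∧out≡out w with w Finₚ.≟ v
    ... | no _     = refl
    ... | yes refl = sym (loopless D v)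

  arcsTo : (q : Fin n → Bool) → q ⊆ᵇ far → ArcSet D
  arcsTo q q⊆far = record { new = λ u w → isV u ∧ q w ; notLoop = notLoop′ ; notInD = notInD′ }
    where
    notLoop′ : ∀ u w → isV u ∧ q w ≡ true → u ≢ w
    notLoop′ u w e with u Finₚ.≟ v | e
    ... | yes refl | qw = λ v≡w → far⇒≢v w (q⊆far w qw) (sym v≡w)
    notInD′ : ∀ u w → isV u ∧ q w ≡ true → arc D u w ≡ false
    notInD′ u w e with u Finₚ.≟ v | e
    ... | yes refl | qw = far⇒¬out w (q⊆far w qw)

  idf : (Fin n → Bool) → Fin n → Fin 3
  idf q w = twoOrOne (isV w) (not (out w ∨ q w))

  idf-isIDF : ∀ q (a : Arcs n) → (∀ w → out w ∨ q w ≡ true → a v w ≡ true) → IsIDFᵃ a (idf q)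
  idf-isIDF q a covers w idf-w≡0 =
    inj₂ (v , covers w (Boolₚ.not-injective (twoOrOne≡𝟘 (isV w) _ idf-w≡0)) , idf-v≡𝟚)
    where
    idf-v≡𝟚 : idf q v ≡ 𝟚
    idf-v≡𝟚 = cong (λ b → twoOrOne b (not (out v ∨ q v))) (dec-true (v Finₚ.≟ v) refl)

  weight-idf : ∀ {q} → q ⊆ᵇ far → weight (idf q) + count q ≡ 2 + count far
  weight-idf {q} q⊆far = begin
    weight (idf q) + count q
      ≡⟨ cong (_+ count q) (weight-twoOrOne isV (λ w → not (out w ∨ q w))) ⟩
    count isV + count isV + count (λ w → not (isV w) ∧ not (out w ∨ q w)) + count q
      ≡⟨ cong₂ (λ c d → c + c + d + count q) (count-singleton v)
               (count-cong (λ w → not-∧-not-∨ (isV w) (out w) (q w))) ⟩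
    2 + count (λ w → far w ∧ not (q w)) + count q
      ≡⟨ cong (2 +_) (+-comm _ (count q)) ⟩
    2 + (count q + count (λ w → far w ∧ not (q w)))
      ≡⟨ cong (λ c → 2 + (c + count (λ w → far w ∧ not (q w)))) (sym (count-∧-⊆ q⊆far)) ⟩
    2 + (count (λ w → far w ∧ q w) + count (λ w → far w ∧ not (q w)))
      ≡⟨ cong (2 +_) (sym (count-split far q)) ⟩
    2 + count far
      ∎
    where open ≡-Reasoning

  γ≤2+far : ∀ {γ} → IsItalianDomNumber D γ → γ ≤ 2 + count far
  γ≤2+far {γ} (_ , γ-least) = subst (γ ≤_) weight≡ (γ-least (idf none) (idf-isIDF none (arc D) covers))
    where
    none : Fin n → Bool
    none _ = false
    covers : ∀ w → out w ∨ false ≡ true → out w ≡ true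
    covers w = trans (sym (Boolₚ.∨-identityʳ (out w)))
    weight≡ : weight (idf none) ≡ 2 + count far
    weight≡ = begin
      weight (idf none)              ≡⟨ sym (+-identityʳ _) ⟩
      weight (idf none) + 0          ≡⟨ cong (weight (idf none) +_) (sym (count-false n)) ⟩
      weight (idf none) + count none ≡⟨ weight-idf (λ _ ()) ⟩
      2 + count far                  ∎
      where open ≡-Reasoning

  reinforcementSet-of-size : ∀ {γ k} → IsItalianDomNumber D γ → 3 ≤ γ → γ + k ≡ 3 + count far →
    ∃ λ R → IsItalianReinforcementSet D R × size R ≡ k
  reinforcementSet-of-size {γ} {k} γ-dom 3≤γ γ+k≡ =
    let q , q⊆far , #q≡k = count-select far k≤far
        1+weight≡γ : suc (weight (idf q)) ≡ γ
        1+weight≡γ = +-cancelʳ-≡ k _ _ (begin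
          suc (weight (idf q)) + k       ≡⟨ cong (λ c → suc (weight (idf q) + c)) (sym #q≡k) ⟩
          suc (weight (idf q) + count q) ≡⟨ cong suc (weight-idf q⊆far) ⟩
          3 + count far                  ≡⟨ sym γ+k≡ ⟩
          γ + k                          ∎)
        covers : ∀ w → out w ∨ q w ≡ true → out w ∨ (isV v ∧ q w) ≡ true
        covers w = subst (λ b → out w ∨ (b ∧ q w) ≡ true) (sym (dec-true (v Finₚ.≟ v) refl))
    in arcsTo q q⊆far
     , Reinforcement.lighterIDF⇒reinforcing D γ-dom (arcsTo q q⊆far)
         (idf q , idf-isIDF q _ covers , ≤-reflexive 1+weight≡γ)
     , trans (sumF-count-row v q) #q≡k
    where
    open ≡-Reasoning
    k≤far : k ≤ count far
    k≤far = +-cancelˡ-≤ 3 k (count far) (subst (3 + k ≤_) γ+k≡ (+-monoˡ-≤ k 3≤γ))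

theorem4p4 : (n : ℕ) (D : Digraph n) (γ : ℕ) → IsItalianDomNumber D γ → 3 ≤ γ →
    ∃ λ r → IsItalianReinforcementNumber D r × r + Δ⁺ D + γ ≤ n + 2
theorem4p4 zero D γ ((_ , _ , refl) , _) ()
theorem4p4 (suc n) D γ γ-dom 3≤γ =
  let v , outdeg≡Δ = maxF-attained (outdeg D)
      open Construction D v
      k , γ+k≡ = m≤n⇒∃[o]m+o≡n (m≤n⇒m≤1+n (γ≤2+far γ-dom))
      R , reinforcing , size≡k = reinforcementSet-of-size γ-dom 3≤γ γ+k≡
      r , r-number , r≤size = Reinforcement.reinforcementNumber-exists D γ-dom 3≤γ R reinforcing
      n≡1+Δ+far = subst (λ Δ → suc n ≡ suc (Δ + count far)) outdeg≡Δ n≡1+outdeg+far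
  in r , r-number , (begin
       r + Δ⁺ D + γ ≤⟨ +-monoˡ-≤ γ (+-monoˡ-≤ (Δ⁺ D) (subst (r ≤_) size≡k r≤size)) ⟩
       k + Δ⁺ D + γ ≡⟨ k+Δ+γ≡n+2 {Δ = Δ⁺ D} {k = k} n≡1+Δ+far γ+k≡ ⟩
       suc n + 2    ∎)
  where open ≤-Reasoning
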